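{- For integers $i,j\ge0$, let $\beta^{(i,j)}$ be the partition whose parts are $3m-1,3m-1,3m$ for $m=1,\ldots,j$ together with $3j+2m$ for $m=1,\ldots,i$. Let $\mathcal{P}_i$ be the set of partitions with at most $i$ parts and $\mathcal{T}^3_j$ the set of partitions into multiples of $3$ with at most $j$ parts. Let $\mathcal{W}_{i,j}$ be the set of partitions $\lambda_1\le\lambda_2\le\cdots\le\lambda_{i+3j}$ into exactly $i+3j$ parts such that (1) each part occurs at most twice, (2) the smallest part is at least $2$, (3) exactly $j$ part sizes occur twice, and (4) for $1\le k\le i+3j$, with the conventions $\lambda_0=0$ and $\lambda_{i+3j+1}=+\infty$: if $\lambda_k-\lambda_{k-1}=0$ then $\lambda_{k+1}-\lambda_k=1$; if $\lambda_k-\lambda_{k-1}=1$ then $\lambda_{k+1}-\lambda_k\ge2$; if $\lambda_k-\lambda_{k-1}\ge2$ then $\lambda_{k+1}-\lambda_k\ge2$ or $\lambda_{k+1}-\lambda_k=0$. Then there exists a bijection $$\varphi'_{3,1}:\{\beta^{(i,j)}\}\times\mathcal{P}_i\times\mathcal{T}^3_j\to\mathcal{W}_{i,j},\quad(\beta^{(i,j)},\mu,\eta)\mapsto\lambda,$$ such that $|\lambda|=|\beta^{(i,j)}|+|\mu|+|\eta|$, $\ell(\lambda)=\ell(\beta^{(i,j)})$ and $\ell_r(\lambda)=\ell_r(\beta^{(i,j)})$.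
   Context: A partition is a weakly increasing list of positive integers (empty allowed); $|\lambda|$ is the sum of its parts, $\ell(\lambda)$ the number of parts, and $\ell_r(\lambda)$ the number of part sizes occurring more than once. -}

module Defs where

open import Data.Bool using (Bool; true; false; _∧_; _∨_; not; T)
open import Data.Nat using (ℕ; zero; suc; _+_; _*_; _∸_; _≡ᵇ_; _≤ᵇ_; _<ᵇ_; _%_)
open import Data.List using (List; []; _∷_; _++_; length; filterᵇ; deduplicateᵇ; applyUpTo; concat)
open import Data.Bool.ListAction using (all)
open import Data.Nat.ListAction using (sum)
open import Data.Maybe using (Maybe; just; nothing)
open import Data.Product using (Σ; _×_)

-- Predicates are Bool-valued (wrapped in T) so that membership proofs are
-- proof-irrelevant and equality in the subset types is equality of lists.

weaklyIncr : List ℕ → Bool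
weaklyIncr [] = true
weaklyIncr (x ∷ []) = true
weaklyIncr (x ∷ y ∷ ys) = (x ≤ᵇ y) ∧ weaklyIncr (y ∷ ys)

isPartition : List ℕ → Bool
isPartition xs = weaklyIncr xs ∧ all (λ x → 1 ≤ᵇ x) xs

size : List ℕ → ℕ
size = sum

len : List ℕ → ℕ
len = length

count : ℕ → List ℕ → ℕ
count v [] = 0
count v (x ∷ xs) with v ≡ᵇ x
... | true  = suc (count v xs)
... | false = count v xs

ℓr : List ℕ → ℕ
ℓr xs = length (filterᵇ (λ v → 2 ≤ᵇ count v xs) (deduplicateᵇ _≡ᵇ_ xs))

β : ℕ → ℕ → List ℕ
β i j = concat (applyUpTo (λ k → let m = suc k in (3 * m ∸ 1) ∷ (3 * m ∸ 1) ∷ (3 * m) ∷ []) j)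
        ++ applyUpTo (λ k → 3 * j + 2 * suc k) i

inP : ℕ → List ℕ → Bool
inP i μ = isPartition μ ∧ (length μ ≤ᵇ i)

𝒫 : ℕ → Set
𝒫 i = Σ (List ℕ) (λ μ → T (inP i μ))

inT3 : ℕ → List ℕ → Bool
inT3 j η = isPartition η ∧ all (λ x → x % 3 ≡ᵇ 0) η ∧ (length η ≤ᵇ j)

𝒯³ : ℕ → Set
𝒯³ j = Σ (List ℕ) (λ η → T (inT3 j η))

-- Condition (4). Gaps d_k = λ_k − λ_{k−1} with λ₀ = 0 and λ_{n+1} = +∞;
-- the gap d_{n+1} = ∞ is represented by `nothing`.
geq2 : Maybe ℕ → Bool
geq2 nothing  = true
geq2 (just d) = 2 ≤ᵇ d

is1 : Maybe ℕ → Bool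
is1 nothing  = false
is1 (just d) = d ≡ᵇ 1

is0 : Maybe ℕ → Bool
is0 nothing  = false
is0 (just d) = d ≡ᵇ 0

gapRule : ℕ → Maybe ℕ → Bool
gapRule zero          d' = is1 d'
gapRule (suc zero)    d' = geq2 d'
gapRule (suc (suc _)) d' = geq2 d' ∨ is0 d'

nextGap : ℕ → List ℕ → Maybe ℕ
nextGap x []      = nothing
nextGap x (y ∷ _) = just (y ∸ x)

cond4 : ℕ → List ℕ → Bool
cond4 prev [] = true
cond4 prev (x ∷ xs) = gapRule (x ∸ prev) (nextGap x xs) ∧ cond4 x xs

smallestAtLeast2 : List ℕ → Bool
smallestAtLeast2 [] = true
smallestAtLeast2 (x ∷ _) = 2 ≤ᵇ x

inW : ℕ → ℕ → List ℕ → Bool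
inW i j λs =
  isPartition λs
  ∧ (length λs ≡ᵇ i + 3 * j)
  ∧ all (λ v → count v λs ≤ᵇ 2) λs
  ∧ smallestAtLeast2 λs
  ∧ (ℓr λs ≡ᵇ j)
  ∧ cond4 0 λs

𝒲 : ℕ → ℕ → Set
𝒲 i j = Σ (List ℕ) (λ λs → T (inW i j λs))

-- An element λ of 𝒲_{i,j} is a row of i singles x and j triples x, x, x + 1, each block starting
-- at least 2 above the last part of the previous one, and the first at least 2: conditions (1)–(4)
-- say exactly this. Give each single the coordinate a, the total excess of the block starts over
-- these minimal values up to and including it, and each triple the coordinate c, that total plus
-- the number of singles before it. Both sequences are weakly increasing, so the a's are the parts
-- of some μ ∈ 𝒫_i padded with zeros and the 3c's those of some η ∈ 𝒯³_j; conversely the row is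
-- rebuilt greedily, the next block being a triple iff its c, minus the number of singles already
-- placed, is at most the a of the next single. All coordinates vanish exactly for β^{(i,j)}, and
-- |λ| = |β^{(i,j)}| + Σ a + 3 Σ c: relative to β^{(i,j)}, a single placed before a triple is 3
-- lower and each part of that triple 2 higher.

{-# OPTIONS --safe #-}
module Submission where

open import Defs
open import Data.Nat using (ℕ; _+_)
open import Data.Product using (Σ; _×_; _,_; proj₁; proj₂)
open import Relation.Binary.PropositionalEquality using (_≡_)
open import Function.Definitions using (Bijective)

open import Data.Bool using (Bool; true; false; _∧_; _∨_; T)
open import Data.Bool.Properties using (T-∧; T-∨; T-irrelevant)
open import Data.Bool.ListAction using (all)
open import Data.Empty using (⊥-elim)
open import Data.List
  using (List; []; _∷_; _++_; length; map; replicate; concat; applyUpTo; filterᵇ; deduplicateᵇ)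
import Data.List.Properties as List
open import Data.List.Relation.Unary.All as All using (All; []; _∷_)
open import Data.List.Relation.Unary.All.Properties using (all⁺; all⁻; deduplicate⁺; map⁺)
open import Data.Maybe using (just; nothing)
open import Data.Nat
  using (zero; suc; _*_; _∸_; _≤_; _<_; _≤ᵇ_; _≡ᵇ_; _%_; _/_; z≤n; s≤s; z<s; NonZero; >-nonZero; >-nonZero⁻¹)
open import Data.Nat.Properties
open import Data.Nat.Divisibility using (_∣_; m%n≡0⇒n∣m; n∣m⇒m%n≡0; m∣m*n; ∣⇒≤)
open import Data.Nat.DivMod using (m*[n/m]≡n; m*n/n≡m; /-monoˡ-≤; m≥n⇒m/n>0)
open import Data.Nat.Tactic.RingSolver using (solve-∀)
open import Data.Product using (∃)
import Data.Product as Product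
open import Data.Product.Properties using (Σ-≡,≡→≡)
open import Data.Sum using (inj₁; inj₂)
open import Data.Unit using (⊤; tt)
open import Function using (_∘_)
open import Function.Bundles using (module Equivalence)
open import Function.Consequences.Propositional using (strictlySurjective⇒surjective)
open import Relation.Binary.PropositionalEquality
  using (refl; sym; trans; cong; cong₂; subst; subst₂; _≢_; module ≡-Reasoning)
open import Relation.Nullary using (yes; no; ¬_; ¬?)
open import Relation.Nullary.Decidable using (T?)


∧-intro : ∀ {a b} → T a → T b → T (a ∧ b)
∧-intro p q = Equivalence.from T-∧ (p , q)

∧-elim : ∀ {a b} → T (a ∧ b) → T a × T b
∧-elim {a} = Equivalence.to (T-∧ {a})

headAtLeast : ℕ → List ℕ → Set
headAtLeast m []      = ⊤
headAtLeast m (x ∷ _) = m ≤ x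

headAtLeast-0 : ∀ xs → headAtLeast 0 xs
headAtLeast-0 []      = tt
headAtLeast-0 (_ ∷ _) = z≤n

All⇒headAtLeast : ∀ {m xs} → All (m ≤_) xs → headAtLeast m xs
All⇒headAtLeast []        = tt
All⇒headAtLeast (m≤x ∷ _) = m≤x

weaklyIncr-∷ : ∀ {x} xs → headAtLeast x xs → T (weaklyIncr xs) → T (weaklyIncr (x ∷ xs))
weaklyIncr-∷ []      _   _ = tt
weaklyIncr-∷ (_ ∷ _) x≤y w = ∧-intro (≤⇒≤ᵇ x≤y) w

weaklyIncr-head : ∀ x xs → T (weaklyIncr (x ∷ xs)) → headAtLeast x xs
weaklyIncr-head x []      _ = tt
weaklyIncr-head x (y ∷ _) w = ≤ᵇ⇒≤ x y (proj₁ (∧-elim w))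

weaklyIncr-tail : ∀ x xs → T (weaklyIncr (x ∷ xs)) → T (weaklyIncr xs)
weaklyIncr-tail x []      _ = tt
weaklyIncr-tail x (y ∷ _) w = proj₂ (∧-elim {x ≤ᵇ y} w)

weaklyIncr-map : ∀ {f : ℕ → ℕ} → (∀ {m n} → m ≤ n → f m ≤ f n) →
                 ∀ xs → T (weaklyIncr xs) → T (weaklyIncr (map f xs))
weaklyIncr-map f-mono []           _ = tt
weaklyIncr-map f-mono (x ∷ [])     _ = tt
weaklyIncr-map f-mono (x ∷ y ∷ ys) w =
  let x≤y , w′ = ∧-elim {x ≤ᵇ y} w
  in ∧-intro (≤⇒≤ᵇ (f-mono (≤ᵇ⇒≤ x y x≤y))) (weaklyIncr-map f-mono (y ∷ ys) w′)

isPartition⁺ : ∀ {xs} → T (weaklyIncr xs) → All (1 ≤_) xs → T (isPartition xs)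
isPartition⁺ w pos = ∧-intro w (all⁻ (1 ≤ᵇ_) (All.map ≤⇒≤ᵇ pos))

isPartition⁻ : ∀ {xs} → T (isPartition xs) → T (weaklyIncr xs) × All (1 ≤_) xs
isPartition⁻ {xs} p =
  let w , pos = ∧-elim {weaklyIncr xs} p
  in w , All.map (λ {x} → ≤ᵇ⇒≤ 1 x) (all⁺ (1 ≤ᵇ_) xs pos)

count-≡ : ∀ v xs → count v (v ∷ xs) ≡ suc (count v xs)
count-≡ v xs with v ≡ᵇ v | ≡⇒≡ᵇ v v refl
... | true  | _ = refl
... | false | ()

count-≢ : ∀ {v x} xs → v ≢ x → count v (x ∷ xs) ≡ count v xs
count-≢ {v} {x} xs v≢x with v ≡ᵇ x | ≡ᵇ⇒≡ v x
... | true  | v≡x = ⊥-elim (v≢x (v≡x tt))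
... | false | _   = refl

count-< : ∀ {v} xs → All (v <_) xs → count v xs ≡ 0
count-< []       []           = refl
count-< (x ∷ xs) (v<x ∷ v<xs) = trans (count-≢ xs (<⇒≢ v<x)) (count-< xs v<xs)

count-fresh : ∀ v xs → All (v <_) xs → count v (v ∷ xs) ≡ 1
count-fresh v xs v<xs = trans (count-≡ v xs) (cong suc (count-< xs v<xs))

deduplicateᵇ-fresh : ∀ x xs → All (x ≢_) xs → deduplicateᵇ _≡ᵇ_ (x ∷ xs) ≡ x ∷ deduplicateᵇ _≡ᵇ_ xs
deduplicateᵇ-fresh x xs x∉xs = cong (x ∷_) (List.filter-all (λ y → ¬? (T? (x ≡ᵇ y)))
  (deduplicate⁺ (λ y z → T? (y ≡ᵇ z)) (All.map (λ {y} x≢y → x≢y ∘ ≡ᵇ⇒≡ x y) x∉xs)))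

deduplicateᵇ-repeat : ∀ x xs → deduplicateᵇ _≡ᵇ_ (x ∷ x ∷ xs) ≡ deduplicateᵇ _≡ᵇ_ (x ∷ xs)
deduplicateᵇ-repeat x xs = cong (x ∷_) (trans
  (List.filter-reject (λ y → ¬? (T? (x ≡ᵇ y))) (λ x≢x → x≢x (≡⇒≡ᵇ x x refl)))
  (List.filter-idem (λ y → ¬? (T? (x ≡ᵇ y))) (deduplicateᵇ _≡ᵇ_ xs)))

-- Blocks and layouts

data Block : Set where
  single triple : ℕ → Block

-- A block is a single x or a triple x, x, x + 1. In layout p, the value p is the least admissible
-- start of the next block, two above the last part of the previous one, and a block records the
-- excess x ∸ p of its start.
layout : ℕ → List Block → List ℕ
layout p []              = []
layout p (single e ∷ bs) = p + e ∷ layout (2 + (p + e)) bs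
layout p (triple e ∷ bs) = p + e ∷ p + e ∷ suc (p + e) ∷ layout (3 + (p + e)) bs

#single #triple : List Block → ℕ
#single []              = 0
#single (single _ ∷ bs) = suc (#single bs)
#single (triple _ ∷ bs) = #single bs
#triple []              = 0
#triple (single _ ∷ bs) = #triple bs
#triple (triple _ ∷ bs) = suc (#triple bs)

layout-≥ : ∀ p bs → All (p ≤_) (layout p bs)
layout-≥ p []              = []
layout-≥ p (single e ∷ bs) =
  m≤m+n p e ∷ All.map (≤-trans (≤-trans (m≤m+n p e) (m≤n+m _ 2))) (layout-≥ _ bs)
layout-≥ p (triple e ∷ bs) =
  m≤m+n p e ∷ m≤m+n p e ∷ m≤n⇒m≤1+n (m≤m+n p e)
  ∷ All.map (≤-trans (≤-trans (m≤m+n p e) (m≤n+m _ 3))) (layout-≥ _ bs)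

layout-> : ∀ {b} p bs → b < p → All (b <_) (layout p bs)
layout-> p bs b<p = All.map (<-≤-trans b<p) (layout-≥ p bs)

layout-head : ∀ {m} p bs → m ≤ p → headAtLeast m (layout p bs)
layout-head p bs m≤p = All⇒headAtLeast (All.map (≤-trans m≤p) (layout-≥ p bs))

length-layout : ∀ p bs → length (layout p bs) ≡ #single bs + 3 * #triple bs
length-layout p []              = refl
length-layout p (single e ∷ bs) = cong suc (length-layout _ bs)
length-layout p (triple e ∷ bs) =
  trans (cong (3 +_) (length-layout _ bs)) (shift (#single bs) (#triple bs))
  where
  shift : ∀ s t → 3 + (s + 3 * t) ≡ s + 3 * suc t
  shift = solve-∀

layout-weaklyIncr : ∀ p bs → T (weaklyIncr (layout p bs))
layout-weaklyIncr p []              = tt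
layout-weaklyIncr p (single e ∷ bs) =
  weaklyIncr-∷ {p + e} _ (layout-head _ bs (m≤n+m (p + e) 2)) (layout-weaklyIncr _ bs)
layout-weaklyIncr p (triple e ∷ bs) =
  weaklyIncr-∷ {b} (b ∷ suc b ∷ rest) ≤-refl (weaklyIncr-∷ {b} (suc b ∷ rest) (n≤1+n b)
    (weaklyIncr-∷ {suc b} rest (layout-head _ bs (m≤n+m (suc b) 2)) (layout-weaklyIncr _ bs)))
  where
  b = p + e
  rest = layout (3 + b) bs

module _ (p e : ℕ) (bs : List Block) where

  private
    b = p + e

  count-single : count (p + e) (layout p (single e ∷ bs)) ≡ 1
  count-single = count-fresh b _ (layout-> _ bs (m<n+m b {2} z<s))

  count-triple : count (p + e) (layout p (triple e ∷ bs)) ≡ 2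
  count-triple =
    trans (count-≡ b _) (cong suc (count-fresh b _ (n<1+n b ∷ layout-> _ bs (m<n+m b {3} z<s))))

  count-triple-top : count (suc (p + e)) (layout p (triple e ∷ bs)) ≡ 1
  count-triple-top = trans (count-≢ _ (>⇒≢ (n<1+n b))) (trans (count-≢ _ (>⇒≢ (n<1+n b)))
    (count-fresh (suc b) _ (layout-> _ bs (m<n+m (suc b) {2} z<s))))

count-layout≤2 : ∀ p bs v → count v (layout p bs) ≤ 2
count-layout≤2 p []              v = z≤n
count-layout≤2 p (single e ∷ bs) v with v ≟ p + e
... | yes refl = ≤-trans (≤-reflexive (count-single p e bs)) (n≤1+n 1)
... | no v≢b   = ≤-trans (≤-reflexive (count-≢ _ v≢b)) (count-layout≤2 _ bs v)
count-layout≤2 p (triple e ∷ bs) v with v ≟ p + e | v ≟ suc (p + e)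
... | yes refl | _        = ≤-reflexive (count-triple p e bs)
... | no _     | yes refl = ≤-trans (≤-reflexive (count-triple-top p e bs)) (n≤1+n 1)
... | no v≢b   | no v≢b+1 = ≤-trans (≤-reflexive (trans (count-≢ _ v≢b)
                              (trans (count-≢ _ v≢b) (count-≢ _ v≢b+1)))) (count-layout≤2 _ bs v)

repeatedIn : List ℕ → List ℕ → List ℕ
repeatedIn L xs = filterᵇ (λ v → 2 ≤ᵇ count v L) (deduplicateᵇ _≡ᵇ_ xs)

-- ℓr xs is length (repeatedIn xs xs); the counts are taken in a fixed list L so that the
-- induction can run over suffixes of a layout.
length-repeatedIn-layout : ∀ L p bs → (∀ v → p ≤ v → count v L ≡ count v (layout p bs)) →
                           length (repeatedIn L (layout p bs)) ≡ #triple bs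
length-repeatedIn-layout L p [] _ = refl
length-repeatedIn-layout L p (single e ∷ bs) agree = begin
    length (filterᵇ P (deduplicateᵇ _≡ᵇ_ (b ∷ rest)))
  ≡⟨ cong (length ∘ filterᵇ P) (deduplicateᵇ-fresh b rest (All.map <⇒≢ (layout-> _ bs b<2+b))) ⟩
    length (filterᵇ P (b ∷ deduplicateᵇ _≡ᵇ_ rest))
  ≡⟨ cong length (List.filter-reject (T? ∘ P) b-once) ⟩
    length (repeatedIn L rest)
  ≡⟨ length-repeatedIn-layout L (2 + b) bs agree-rest ⟩
    #triple bs ∎
  where
  open ≡-Reasoning
  b = p + e
  rest = layout (2 + b) bs
  P = λ v → 2 ≤ᵇ count v L
  b<2+b = m<n+m b {2} z<s
  b-once : ¬ T (P b)
  b-once = subst (T ∘ (2 ≤ᵇ_)) (trans (agree b (m≤m+n p e)) (count-single p e bs))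
  agree-rest : ∀ v → 2 + b ≤ v → count v L ≡ count v rest
  agree-rest v 2+b≤v =
    trans (agree v (≤-trans (m≤m+n p e) (<⇒≤ (<-≤-trans b<2+b 2+b≤v))))
          (count-≢ rest (>⇒≢ (<-≤-trans b<2+b 2+b≤v)))
length-repeatedIn-layout L p (triple e ∷ bs) agree = begin
    length (filterᵇ P (deduplicateᵇ _≡ᵇ_ (b ∷ b ∷ suc b ∷ rest)))
  ≡⟨ cong (length ∘ filterᵇ P) distinct ⟩
    length (filterᵇ P (b ∷ suc b ∷ deduplicateᵇ _≡ᵇ_ rest))
  ≡⟨ cong length (List.filter-accept (T? ∘ P) b-twice) ⟩
    suc (length (filterᵇ P (suc b ∷ deduplicateᵇ _≡ᵇ_ rest)))
  ≡⟨ cong (suc ∘ length) (List.filter-reject (T? ∘ P) b+1-once) ⟩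
    suc (length (repeatedIn L rest))
  ≡⟨ cong suc (length-repeatedIn-layout L (3 + b) bs agree-rest) ⟩
    suc (#triple bs) ∎
  where
  open ≡-Reasoning
  b = p + e
  rest = layout (3 + b) bs
  P = λ v → 2 ≤ᵇ count v L
  b<3+b = m<n+m b {3} z<s
  b+1<3+b = m<n+m (suc b) {2} z<s
  distinct : deduplicateᵇ _≡ᵇ_ (b ∷ b ∷ suc b ∷ rest) ≡ b ∷ suc b ∷ deduplicateᵇ _≡ᵇ_ rest
  distinct = trans (deduplicateᵇ-repeat b (suc b ∷ rest))
    (trans (deduplicateᵇ-fresh b (suc b ∷ rest) (<⇒≢ (n<1+n b) ∷ All.map <⇒≢ (layout-> _ bs b<3+b)))
           (cong (b ∷_) (deduplicateᵇ-fresh (suc b) rest (All.map <⇒≢ (layout-> _ bs b+1<3+b)))))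
  b-twice : T (P b)
  b-twice = subst (T ∘ (2 ≤ᵇ_)) (sym (trans (agree b (m≤m+n p e)) (count-triple p e bs))) tt
  b+1-once : ¬ T (P (suc b))
  b+1-once = subst (T ∘ (2 ≤ᵇ_))
    (trans (agree (suc b) (m≤n⇒m≤1+n (m≤m+n p e))) (count-triple-top p e bs))
  agree-rest : ∀ v → 3 + b ≤ v → count v L ≡ count v rest
  agree-rest v 3+b≤v =
    trans (agree v (≤-trans (m≤m+n p e) (<⇒≤ b<v)))
          (trans (count-≢ _ (>⇒≢ b<v)) (trans (count-≢ _ (>⇒≢ b<v))
                 (count-≢ rest (>⇒≢ (<-≤-trans b+1<3+b 3+b≤v)))))
    where b<v = <-≤-trans b<3+b 3+b≤v

ℓr-layout : ∀ p bs → ℓr (layout p bs) ≡ #triple bs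
ℓr-layout p bs = length-repeatedIn-layout (layout p bs) p bs (λ _ _ → refl)

cond4-head : ∀ q x xs → T (cond4 q (x ∷ xs)) → T (gapRule (x ∸ q) (nextGap x xs))
cond4-head q x xs c = proj₁ (∧-elim c)

cond4-tail : ∀ q x xs → T (cond4 q (x ∷ xs)) → T (cond4 x xs)
cond4-tail q x xs c = proj₂ (∧-elim {gapRule (x ∸ q) (nextGap x xs)} c)

gapRule-≥2 : ∀ {d} d′ → 2 ≤ d → gapRule d d′ ≡ (geq2 d′ ∨ is0 d′)
gapRule-≥2 {suc zero}    _ (s≤s ())
gapRule-≥2 {suc (suc _)} _ _ = refl

gapRule-0 : ∀ x d′ → gapRule (x ∸ x) d′ ≡ is1 d′
gapRule-0 x d′ rewrite n∸n≡0 x = refl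

gapRule-1 : ∀ x d′ → gapRule (suc x ∸ x) d′ ≡ geq2 d′
gapRule-1 x d′ rewrite m+n∸n≡m 1 x = refl

nextGap-≥2 : ∀ x xs → headAtLeast (2 + x) xs → T (geq2 (nextGap x xs))
nextGap-≥2 x []      _     = tt
nextGap-≥2 x (y ∷ _) 2+x≤y = ≤⇒≤ᵇ (m+n≤o⇒m≤o∸n 2 2+x≤y)

cond4-layout : ∀ q p bs → 2 + q ≤ p → T (cond4 q (layout p bs))
cond4-layout q p []              _      = tt
cond4-layout q p (single e ∷ bs) 2+q≤p =
  ∧-intro (subst T (sym (gapRule-≥2 _ (start-gap 2+q≤p)))
                   (Equivalence.from T-∨ (inj₁ (nextGap-≥2 _ _ (layout-head _ bs ≤-refl)))))
          (cond4-layout (p + e) _ bs ≤-refl)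
  where
  start-gap : 2 + q ≤ p → 2 ≤ p + e ∸ q
  start-gap h = m+n≤o⇒m≤o∸n 2 (≤-trans h (m≤m+n p e))
cond4-layout q p (triple e ∷ bs) 2+q≤p =
  ∧-intro (subst T (sym (gapRule-≥2 _ start-gap))
                   (Equivalence.from (T-∨ {geq2 (just (b ∸ b))}) (inj₂ (≡⇒≡ᵇ _ 0 (n∸n≡0 b)))))
  (∧-intro (subst T (sym (gapRule-0 b _)) (≡⇒≡ᵇ _ 1 (m+n∸n≡m 1 b)))
  (∧-intro (subst T (sym (gapRule-1 b _)) (nextGap-≥2 _ _ (layout-head _ bs ≤-refl)))
           (cond4-layout (suc b) _ bs ≤-refl)))
  where
  b = p + e
  start-gap : 2 ≤ b ∸ q
  start-gap = m+n≤o⇒m≤o∸n 2 (≤-trans 2+q≤p (m≤m+n p e))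

smallestAtLeast2⁺ : ∀ xs → headAtLeast 2 xs → T (smallestAtLeast2 xs)
smallestAtLeast2⁺ []      _   = tt
smallestAtLeast2⁺ (_ ∷ _) 2≤x = ≤⇒≤ᵇ 2≤x

smallestAtLeast2⁻ : ∀ xs → T (smallestAtLeast2 xs) → headAtLeast 2 xs
smallestAtLeast2⁻ []      _ = tt
smallestAtLeast2⁻ (x ∷ _) t = ≤ᵇ⇒≤ 2 x t

inW⁺ : ∀ {i j xs} → T (isPartition xs) → length xs ≡ i + 3 * j → (∀ v → count v xs ≤ 2) →
       headAtLeast 2 xs → ℓr xs ≡ j → T (cond4 0 xs) → T (inW i j xs)
inW⁺ {i} {j} {xs} part len mult smallest repeated c4 =
  ∧-intro part
  (∧-intro {length xs ≡ᵇ i + 3 * j} (≡⇒≡ᵇ _ _ len)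
  (∧-intro {all (λ v → count v xs ≤ᵇ 2) xs} (all⁻ _ {xs} (All.tabulate (λ {v} _ → ≤⇒≤ᵇ (mult v))))
  (∧-intro {smallestAtLeast2 xs} (smallestAtLeast2⁺ xs smallest)
  (∧-intro {ℓr xs ≡ᵇ j} (≡⇒≡ᵇ _ _ repeated) c4))))

inW⁻ : ∀ {i j} xs → T (inW i j xs) →
       T (weaklyIncr xs) × length xs ≡ i + 3 * j × headAtLeast 2 xs × ℓr xs ≡ j × T (cond4 0 xs)
inW⁻ {i} {j} xs w∈ =
  let part , w∈₁ = ∧-elim {isPartition xs} w∈
      len , w∈₂ = ∧-elim {length xs ≡ᵇ i + 3 * j} w∈₁
      _ , w∈₃ = ∧-elim {all (λ v → count v xs ≤ᵇ 2) xs} w∈₂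
      smallest , w∈₄ = ∧-elim {smallestAtLeast2 xs} w∈₃
      repeated , c4 = ∧-elim {ℓr xs ≡ᵇ j} w∈₄
  in proj₁ (isPartition⁻ {xs} part) , ≡ᵇ⇒≡ _ _ len , smallestAtLeast2⁻ xs smallest ,
     ≡ᵇ⇒≡ _ _ repeated , c4

𝒲-statistics : ∀ {i j} xs → T (inW i j xs) → len xs ≡ i + 3 * j × ℓr xs ≡ j
𝒲-statistics {i} {j} xs xs∈ = let _ , length≡ , _ , ℓr≡ , _ = inW⁻ {i} {j} xs xs∈ in length≡ , ℓr≡

layout-∈𝒲 : ∀ bs → T (inW (#single bs) (#triple bs) (layout 2 bs))
layout-∈𝒲 bs =
  inW⁺ {#single bs}
       (isPartition⁺ {layout 2 bs} (layout-weaklyIncr 2 bs) (All.map (≤-trans (s≤s z≤n)) (layout-≥ 2 bs)))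
       (length-layout 2 bs) (count-layout≤2 2 bs) (layout-head 2 bs ≤-refl) (ℓr-layout 2 bs)
       (cond4-layout 0 2 bs ≤-refl)

-- Elements of 𝒲 as layouts

single≢triple : ∀ p e e′ bs cs → layout p (single e ∷ bs) ≢ layout p (triple e′ ∷ cs)
single≢triple p e e′ bs cs eq = 1+n≰n (≤-trans (n≤1+n _) (subst (2 + (p + e) ≤_) b′≡b 2+b≤b′))
  where
  b′≡b : p + e′ ≡ p + e
  b′≡b = sym (List.∷-injectiveˡ eq)
  2+b≤b′ : 2 + (p + e) ≤ p + e′
  2+b≤b′ = All.head (subst (All (2 + (p + e) ≤_)) (List.∷-injectiveʳ eq) (layout-≥ _ bs))

layout-injective : ∀ p {bs cs} → layout p bs ≡ layout p cs → bs ≡ cs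
layout-injective p {[]}            {[]}             _  = refl
layout-injective p {[]}            {single _ ∷ _}   ()
layout-injective p {[]}            {triple _ ∷ _}   ()
layout-injective p {single _ ∷ _}  {[]}             ()
layout-injective p {triple _ ∷ _}  {[]}             ()
layout-injective p {single e ∷ bs} {single e′ ∷ cs} eq
  with refl ← +-cancelˡ-≡ p e e′ (List.∷-injectiveˡ eq)
  = cong (single e ∷_) (layout-injective _ (List.∷-injectiveʳ eq))
layout-injective p {triple e ∷ bs} {triple e′ ∷ cs} eq
  with refl ← +-cancelˡ-≡ p e e′ (List.∷-injectiveˡ eq)
  = cong (triple e ∷_) (layout-injective _
      (List.∷-injectiveʳ (List.∷-injectiveʳ (List.∷-injectiveʳ eq))))
layout-injective p {single e ∷ bs} {triple e′ ∷ cs} eq = ⊥-elim (single≢triple p e e′ bs cs eq)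
layout-injective p {triple e ∷ bs} {single e′ ∷ cs} eq = ⊥-elim (single≢triple p e′ e cs bs (sym eq))

single-at : ∀ {q x} → 2 + q ≤ x → ∀ bs →
            layout (2 + q) (single (x ∸ (2 + q)) ∷ bs) ≡ x ∷ layout (2 + x) bs
single-at h bs rewrite m+[n∸m]≡n h = refl

triple-at : ∀ {q x} → 2 + q ≤ x → ∀ bs →
            layout (2 + q) (triple (x ∸ (2 + q)) ∷ bs) ≡ x ∷ x ∷ suc x ∷ layout (3 + x) bs
triple-at h bs rewrite m+[n∸m]≡n h = refl

-- What condition (4) allows after a part x that is preceded by a gap of at least 2.
data Continuation (x : ℕ) : List ℕ → Set where
  end     : Continuation x []
  spaced  : ∀ {y ys} → 2 + x ≤ y → Continuation x (y ∷ ys)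
  tripled : ∀ {zs} → headAtLeast (3 + x) zs → Continuation x (x ∷ suc x ∷ zs)

nextGap-≥2⁻ : ∀ x xs → headAtLeast x xs → T (geq2 (nextGap x xs)) → headAtLeast (2 + x) xs
nextGap-≥2⁻ x []      _   _   = tt
nextGap-≥2⁻ x (y ∷ _) x≤y gap = m≤o∸n⇒m+n≤o 2 x≤y (≤ᵇ⇒≤ 2 _ gap)

∸≡1⇒≡suc : ∀ {x z} → x ≤ z → z ∸ x ≡ 1 → suc x ≡ z
∸≡1⇒≡suc {x} x≤z z∸x≡1 = trans (+-comm 1 x) (trans (cong (x +_) (sym z∸x≡1)) (m+[n∸m]≡n x≤z))

continuation : ∀ q x rest → 2 + q ≤ x → T (weaklyIncr (x ∷ rest)) → T (cond4 q (x ∷ rest)) →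
               Continuation x rest
continuation q x []       _     _ _ = end
continuation q x (y ∷ ys) 2+q≤x w c
  with Equivalence.to T-∨ (subst T (gapRule-≥2 _ (m+n≤o⇒m≤o∸n 2 2+q≤x)) (cond4-head q x _ c))
... | inj₁ gap≥2 = spaced (nextGap-≥2⁻ x (y ∷ ys) (weaklyIncr-head x (y ∷ ys) w) gap≥2)
... | inj₂ gap≡0
  with refl ← ≤-antisym (m∸n≡0⇒m≤n (≡ᵇ⇒≡ (y ∸ x) 0 gap≡0)) (weaklyIncr-head x (y ∷ ys) w)
  = after-repeat ys (weaklyIncr-tail x (x ∷ ys) w) (cond4-tail q x _ c)
  where
  after-repeat : ∀ ys → T (weaklyIncr (x ∷ ys)) → T (cond4 x (x ∷ ys)) → Continuation x (x ∷ ys)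
  after-repeat []       _  c′ = ⊥-elim (subst T (gapRule-0 x nothing) (cond4-head x x [] c′))
  after-repeat (z ∷ zs) w′ c′
    with refl ← ∸≡1⇒≡suc (weaklyIncr-head x (z ∷ zs) w′)
                  (≡ᵇ⇒≡ (z ∸ x) 1 (subst T (gapRule-0 x _) (cond4-head x x _ c′)))
    = tripled (nextGap-≥2⁻ (suc x) zs (weaklyIncr-head (suc x) zs (weaklyIncr-tail x (suc x ∷ zs) w′))
                (subst T (gapRule-1 x _) (cond4-head x (suc x) zs (cond4-tail x x _ c′))))

unlayout : ∀ q xs → headAtLeast (2 + q) xs → T (weaklyIncr xs) → T (cond4 q xs) →
           ∃ λ bs → layout (2 + q) bs ≡ xs
unlayout q []         _     _ _ = [] , refl
unlayout q (x ∷ rest) 2+q≤x w c with continuation q x rest 2+q≤x w c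
... | end = single (x ∸ (2 + q)) ∷ [] , single-at 2+q≤x []
... | spaced 2+x≤y =
  let bs , eq = unlayout x rest 2+x≤y (weaklyIncr-tail x rest w) (cond4-tail q x rest c)
  in single (x ∸ (2 + q)) ∷ bs , trans (single-at 2+q≤x bs) (cong (x ∷_) eq)
... | tripled {zs} 3+x≤z =
  let w′ = weaklyIncr-tail (suc x) zs
             (weaklyIncr-tail x (suc x ∷ zs) (weaklyIncr-tail x (x ∷ suc x ∷ zs) w))
      c′ = cond4-tail x (suc x) zs (cond4-tail x x _ (cond4-tail q x _ c))
      bs , eq = unlayout (suc x) zs 3+x≤z w′ c′
  in triple (x ∸ (2 + q)) ∷ bs , trans (triple-at 2+q≤x bs) (cong (λ ys → x ∷ x ∷ suc x ∷ ys) eq)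

𝒲⇒layout : ∀ {i j w} → T (inW i j w) → ∃ λ bs → #single bs ≡ i × #triple bs ≡ j × layout 2 bs ≡ w
𝒲⇒layout {i} {j} {w} w∈ =
  let weaklyIncr-w , length-w , smallest-w , ℓr-w , cond4-w = inW⁻ {i} {j} w w∈
      bs , bs↦w = unlayout 0 w smallest-w weaklyIncr-w cond4-w
      #triple≡j = trans (sym (ℓr-layout 2 bs)) (trans (cong ℓr bs↦w) ℓr-w)
      #single≡i = +-cancelʳ-≡ (3 * j) (#single bs) i (begin
        #single bs + 3 * j            ≡⟨ cong (λ t → #single bs + 3 * t) (sym #triple≡j) ⟩
        #single bs + 3 * #triple bs   ≡⟨ sym (length-layout 2 bs) ⟩
        length (layout 2 bs)          ≡⟨ cong length bs↦w ⟩
        length w                      ≡⟨ length-w ⟩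
        i + 3 * j                     ∎)
  in bs , #single≡i , #triple≡j , bs↦w
  where open ≡-Reasoning

-- Interleaving

-- ds and gs are the difference sequences of the coordinates a of the singles and c of the triples.
interleave  : List ℕ → List ℕ → List Block
interleave⁺ : ℕ → List ℕ → List ℕ → List Block

interleave []       gs = map triple gs
interleave (d ∷ ds) gs = interleave⁺ d ds gs

interleave⁺ d ds [] = single d ∷ interleave ds []
interleave⁺ d ds (g ∷ gs) with g ≤? d
... | yes _ = triple g ∷ interleave⁺ (d ∸ g) ds gs
... | no  _ = single d ∷ interleave ds (g ∸ suc d ∷ gs)

interleave⁺-triple : ∀ {d g} ds gs → g ≤ d →
                     interleave⁺ d ds (g ∷ gs) ≡ triple g ∷ interleave⁺ (d ∸ g) ds gs
interleave⁺-triple {d} {g} ds gs g≤d with g ≤? d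
... | yes _   = refl
... | no  g≰d = ⊥-elim (g≰d g≤d)

interleave⁺-single : ∀ {d g} ds gs → d < g →
                     interleave⁺ d ds (g ∷ gs) ≡ single d ∷ interleave ds (g ∸ suc d ∷ gs)
interleave⁺-single {d} {g} ds gs d<g with g ≤? d
... | yes g≤d = ⊥-elim (<⇒≱ d<g g≤d)
... | no  _   = refl

addToHead : ℕ → List ℕ → List ℕ
addToHead k []       = []
addToHead k (x ∷ xs) = k + x ∷ xs

deinterleave : List Block → List ℕ × List ℕ
deinterleave []              = [] , []
deinterleave (single e ∷ bs) = Product.map (e ∷_) (addToHead (suc e)) (deinterleave bs)
deinterleave (triple e ∷ bs) = Product.map (addToHead e) (e ∷_) (deinterleave bs)

deinterleave-interleave  : ∀ ds gs → deinterleave (interleave ds gs) ≡ (ds , gs)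
deinterleave-interleave⁺ : ∀ d ds gs → deinterleave (interleave⁺ d ds gs) ≡ (d ∷ ds , gs)

deinterleave-interleave []       []       = refl
deinterleave-interleave []       (g ∷ gs) rewrite deinterleave-interleave [] gs = refl
deinterleave-interleave (d ∷ ds) gs       = deinterleave-interleave⁺ d ds gs

deinterleave-interleave⁺ d ds [] rewrite deinterleave-interleave ds [] = refl
deinterleave-interleave⁺ d ds (g ∷ gs) with g ≤? d
... | yes g≤d rewrite deinterleave-interleave⁺ (d ∸ g) ds gs | m+[n∸m]≡n g≤d = refl
... | no  g≰d rewrite deinterleave-interleave ds (g ∸ suc d ∷ gs) | m+[n∸m]≡n (≰⇒> g≰d) = refl

interleave-deinterleave : ∀ bs → interleave (proj₁ (deinterleave bs)) (proj₂ (deinterleave bs)) ≡ bs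
interleave-deinterleave [] = refl
interleave-deinterleave (single e ∷ bs) with deinterleave bs | interleave-deinterleave bs
... | ds , []     | ih = cong (single e ∷_) ih
... | ds , g ∷ gs | ih = begin
    interleave⁺ e ds (suc e + g ∷ gs)
  ≡⟨ interleave⁺-single ds gs (m≤m+n (suc e) g) ⟩
    single e ∷ interleave ds (suc e + g ∸ suc e ∷ gs)
  ≡⟨ cong (λ g′ → single e ∷ interleave ds (g′ ∷ gs)) (m+n∸m≡n (suc e) g) ⟩
    single e ∷ interleave ds (g ∷ gs)
  ≡⟨ cong (single e ∷_) ih ⟩
    single e ∷ bs ∎
  where open ≡-Reasoning
interleave-deinterleave (triple e ∷ bs) with deinterleave bs | interleave-deinterleave bs
... | []     , gs | ih = cong (triple e ∷_) ih
... | d ∷ ds , gs | ih = begin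
    interleave⁺ (e + d) ds (e ∷ gs)
  ≡⟨ interleave⁺-triple ds gs (m≤m+n e d) ⟩
    triple e ∷ interleave⁺ (e + d ∸ e) ds gs
  ≡⟨ cong (λ d′ → triple e ∷ interleave⁺ d′ ds gs) (m+n∸m≡n e d) ⟩
    triple e ∷ interleave⁺ d ds gs
  ≡⟨ cong (triple e ∷_) ih ⟩
    triple e ∷ bs ∎
  where open ≡-Reasoning

length-addToHead : ∀ k xs → length (addToHead k xs) ≡ length xs
length-addToHead k []      = refl
length-addToHead k (_ ∷ _) = refl

length-deinterleave : ∀ bs → length (proj₁ (deinterleave bs)) ≡ #single bs
                            × length (proj₂ (deinterleave bs)) ≡ #triple bs
length-deinterleave [] = refl , refl
length-deinterleave (single e ∷ bs) =
  let ds≡ , gs≡ = length-deinterleave bs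
  in cong suc ds≡ , trans (length-addToHead (suc e) (proj₂ (deinterleave bs))) gs≡
length-deinterleave (triple e ∷ bs) =
  let ds≡ , gs≡ = length-deinterleave bs
  in trans (length-addToHead e (proj₁ (deinterleave bs))) ds≡ , cong suc gs≡

counts-interleave : ∀ ds gs → #single (interleave ds gs) ≡ length ds
                             × #triple (interleave ds gs) ≡ length gs
counts-interleave ds gs =
  let ds≡ , gs≡ = length-deinterleave (interleave ds gs)
      split≡ = deinterleave-interleave ds gs
  in trans (sym ds≡) (cong (length ∘ proj₁) split≡) , trans (sym gs≡) (cong (length ∘ proj₂) split≡)

weight : List ℕ → ℕ
weight []       = 0
weight (d ∷ ds) = length (d ∷ ds) * d + weight ds

weight-addToHead : ∀ k xs → weight (addToHead k xs) ≡ length xs * k + weight xs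
weight-addToHead k []       = refl
weight-addToHead k (x ∷ xs) =
  trans (cong (_+ weight xs) (*-distribˡ-+ n k x)) (+-assoc (n * k) (n * x) (weight xs))
  where n = length (x ∷ xs)

weight-zeros : ∀ k → weight (replicate k 0) ≡ 0
weight-zeros zero    = refl
weight-zeros (suc k) =
  trans (cong (_+ weight (replicate k 0)) (*-zeroʳ (length (replicate (suc k) 0)))) (weight-zeros k)

-- baseSize a b is the size of layout 0 (interleave (replicate a 0) (replicate b 0)):
-- b triples at 3t, 3t, 3t + 1 followed by a singles at 3b + 2s.
baseSize : ℕ → ℕ → ℕ
baseSize a       (suc b) = baseSize a b + (3 * a + 9 * b + 1)
baseSize zero    zero    = 0
baseSize (suc a) zero    = baseSize a 0 + 2 * a

baseSize-suc : ∀ a b → baseSize (suc a) b ≡ baseSize a b + (2 * a + 3 * b)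
baseSize-suc a zero    = cong (baseSize a 0 +_) (sym (+-identityʳ (2 * a)))
baseSize-suc a (suc b) rewrite baseSize-suc a b = shuffle (baseSize a b) a b
  where
  shuffle : ∀ x a b → x + (2 * a + 3 * b) + (3 * suc a + 9 * b + 1)
                    ≡ x + (3 * a + 9 * b + 1) + (2 * a + 3 * suc b)
  shuffle = solve-∀

layoutSize : ℕ → List ℕ → List ℕ → ℕ
layoutSize p ds gs =
  p * (length ds + 3 * length gs) + baseSize (length ds) (length gs) + weight ds + 3 * weight gs

layoutSize-single : ∀ p d ds gs →
  layoutSize p (d ∷ ds) (addToHead (suc d) gs) ≡ p + d + layoutSize (2 + (p + d)) ds gs
layoutSize-single p d ds gs
  rewrite length-addToHead (suc d) gs | weight-addToHead (suc d) gs | baseSize-suc (length ds) (length gs)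
  = shuffle p d (length ds) (length gs) (baseSize (length ds) (length gs)) (weight ds) (weight gs)
  where
  shuffle : ∀ p d a b x w v →
    p * (suc a + 3 * b) + (x + (2 * a + 3 * b)) + (suc a * d + w) + 3 * (b * suc d + v)
    ≡ p + d + ((2 + (p + d)) * (a + 3 * b) + x + w + 3 * v)
  shuffle = solve-∀

layoutSize-triple : ∀ p g ds gs →
  layoutSize p (addToHead g ds) (g ∷ gs)
  ≡ p + g + (p + g + (suc (p + g) + layoutSize (3 + (p + g)) ds gs))
layoutSize-triple p g ds gs
  rewrite length-addToHead g ds | weight-addToHead g ds
  = shuffle p g (length ds) (length gs) (baseSize (length ds) (length gs)) (weight ds) (weight gs)
  where
  shuffle : ∀ p g a b x w v →
    p * (a + 3 * suc b) + (x + (3 * a + 9 * b + 1)) + (a * g + w) + 3 * (suc b * g + v)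
    ≡ p + g + (p + g + (suc (p + g) + ((3 + (p + g)) * (a + 3 * b) + x + w + 3 * v)))
  shuffle = solve-∀

size-layout : ∀ p bs →
              size (layout p bs) ≡ layoutSize p (proj₁ (deinterleave bs)) (proj₂ (deinterleave bs))
size-layout p [] = sym (cong (λ n → n + 0 + 0 + 0) (*-zeroʳ p))
size-layout p (single e ∷ bs) =
  trans (cong (p + e +_) (size-layout _ bs))
        (sym (layoutSize-single p e (proj₁ (deinterleave bs)) (proj₂ (deinterleave bs))))
size-layout p (triple e ∷ bs) =
  trans (cong (λ n → p + e + (p + e + (suc (p + e) + n))) (size-layout _ bs))
        (sym (layoutSize-triple p e (proj₁ (deinterleave bs)) (proj₂ (deinterleave bs))))

size-layout-interleave : ∀ p ds gs → size (layout p (interleave ds gs)) ≡ layoutSize p ds gs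
size-layout-interleave p ds gs =
  trans (size-layout p (interleave ds gs))
        (cong (λ (ds′ , gs′) → layoutSize p ds′ gs′) (deinterleave-interleave ds gs))

layoutSize-zeros : ∀ p ds gs →
  layoutSize p ds gs
  ≡ layoutSize p (replicate (length ds) 0) (replicate (length gs) 0) + weight ds + 3 * weight gs
layoutSize-zeros p ds gs
  rewrite List.length-replicate (length ds) {0} | List.length-replicate (length gs) {0}
        | weight-zeros (length ds) | weight-zeros (length gs)
  = shuffle (p * (length ds + 3 * length gs) + baseSize (length ds) (length gs)) (weight ds) (weight gs)
  where
  shuffle : ∀ x w v → x + w + 3 * v ≡ x + 0 + 3 * 0 + w + 3 * v
  shuffle = solve-∀

-- Partitions as difference sequences

differences : ℕ → List ℕ → List ℕ
differences p []       = []
differences p (x ∷ xs) = x ∸ p ∷ differences x xs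

partialSums : ℕ → List ℕ → List ℕ
partialSums p []       = []
partialSums p (d ∷ ds) = p + d ∷ partialSums (p + d) ds

length-differences : ∀ p xs → length (differences p xs) ≡ length xs
length-differences p []       = refl
length-differences p (x ∷ xs) = cong suc (length-differences x xs)

length-partialSums : ∀ p ds → length (partialSums p ds) ≡ length ds
length-partialSums p []       = refl
length-partialSums p (d ∷ ds) = cong suc (length-partialSums (p + d) ds)

partialSums-differences : ∀ p xs → headAtLeast p xs → T (weaklyIncr xs) →
                          partialSums p (differences p xs) ≡ xs
partialSums-differences p []       _   _ = refl
partialSums-differences p (x ∷ xs) p≤x w rewrite m+[n∸m]≡n p≤x =
  cong (x ∷_) (partialSums-differences x xs (weaklyIncr-head x xs w) (weaklyIncr-tail x xs w))

differences-partialSums : ∀ p ds → differences p (partialSums p ds) ≡ ds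
differences-partialSums p []       = refl
differences-partialSums p (d ∷ ds) = cong₂ _∷_ (m+n∸m≡n p d) (differences-partialSums (p + d) ds)

partialSums-head : ∀ p ds → headAtLeast p (partialSums p ds)
partialSums-head p []      = tt
partialSums-head p (d ∷ _) = m≤m+n p d

partialSums-weaklyIncr : ∀ p ds → T (weaklyIncr (partialSums p ds))
partialSums-weaklyIncr p []       = tt
partialSums-weaklyIncr p (d ∷ ds) =
  weaklyIncr-∷ {p + d} _ (partialSums-head (p + d) ds) (partialSums-weaklyIncr (p + d) ds)

size-partialSums : ∀ p ds → size (partialSums p ds) ≡ p * length ds + weight ds
size-partialSums p []       = sym (trans (+-identityʳ (p * 0)) (*-zeroʳ p))
size-partialSums p (d ∷ ds) =
  trans (cong (p + d +_) (size-partialSums (p + d) ds)) (shuffle p d (length ds) (weight ds))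
  where
  shuffle : ∀ p d n w → p + d + ((p + d) * n + w) ≡ p * suc n + (suc n * d + w)
  shuffle = solve-∀

pad : ℕ → List ℕ → List ℕ
pad i μ = replicate (i ∸ length μ) 0 ++ μ

dropZeros : List ℕ → List ℕ
dropZeros []           = []
dropZeros (zero  ∷ xs) = dropZeros xs
dropZeros (suc x ∷ xs) = suc x ∷ xs

length-pad : ∀ i μ → length μ ≤ i → length (pad i μ) ≡ i
length-pad i μ len≤i =
  trans (List.length-++ (replicate (i ∸ length μ) 0))
        (trans (cong (_+ length μ) (List.length-replicate (i ∸ length μ))) (m∸n+n≡m len≤i))

size-replicate-0-++ : ∀ k xs → size (replicate k 0 ++ xs) ≡ size xs
size-replicate-0-++ zero    xs = refl
size-replicate-0-++ (suc k) xs = size-replicate-0-++ k xs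

replicate-0-++-weaklyIncr : ∀ k xs → T (weaklyIncr xs) → T (weaklyIncr (replicate k 0 ++ xs))
replicate-0-++-weaklyIncr zero    xs w = w
replicate-0-++-weaklyIncr (suc k) xs w =
  weaklyIncr-∷ {0} (replicate k 0 ++ xs) (headAtLeast-0 (replicate k 0 ++ xs))
    (replicate-0-++-weaklyIncr k xs w)

dropZeros-replicate-0-++ : ∀ k xs → All (1 ≤_) xs → dropZeros (replicate k 0 ++ xs) ≡ xs
dropZeros-replicate-0-++ (suc k) xs       pos       = dropZeros-replicate-0-++ k xs pos
dropZeros-replicate-0-++ zero    []       []        = refl
dropZeros-replicate-0-++ zero    (suc x ∷ xs) (_ ∷ _) = refl

length-dropZeros : ∀ xs → length (dropZeros xs) ≤ length xs
length-dropZeros []           = z≤n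
length-dropZeros (zero  ∷ xs) = m≤n⇒m≤1+n (length-dropZeros xs)
length-dropZeros (suc x ∷ xs) = ≤-refl

pad-dropZeros : ∀ xs → pad (length xs) (dropZeros xs) ≡ xs
pad-dropZeros []           = refl
pad-dropZeros (zero  ∷ xs) rewrite +-∸-assoc 1 (length-dropZeros xs) = cong (0 ∷_) (pad-dropZeros xs)
pad-dropZeros (suc x ∷ xs) rewrite n∸n≡0 (length xs) = refl

dropZeros-isPartition : ∀ xs → T (weaklyIncr xs) → T (isPartition (dropZeros xs))
dropZeros-isPartition []           _ = tt
dropZeros-isPartition (zero  ∷ xs) w = dropZeros-isPartition xs (weaklyIncr-tail 0 xs w)
dropZeros-isPartition (suc x ∷ xs) w = isPartition⁺ {suc x ∷ xs} w (positive (suc x) xs (s≤s z≤n) w)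
  where
  positive : ∀ y ys → 1 ≤ y → T (weaklyIncr (y ∷ ys)) → All (1 ≤_) (y ∷ ys)
  positive y []       1≤y _ = 1≤y ∷ []
  positive y (z ∷ zs) 1≤y w′ =
    1≤y ∷ positive z zs (≤-trans 1≤y (weaklyIncr-head y (z ∷ zs) w′)) (weaklyIncr-tail y (z ∷ zs) w′)

toDifferences : ℕ → List ℕ → List ℕ
toDifferences i μ = differences 0 (pad i μ)

fromDifferences : List ℕ → List ℕ
fromDifferences ds = dropZeros (partialSums 0 ds)

partialSums-toDifferences : ∀ i μ → T (weaklyIncr μ) → partialSums 0 (toDifferences i μ) ≡ pad i μ
partialSums-toDifferences i μ w =
  partialSums-differences 0 (pad i μ) (headAtLeast-0 (pad i μ))
    (replicate-0-++-weaklyIncr (i ∸ length μ) μ w)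

fromDifferences-toDifferences : ∀ i μ → T (isPartition μ) → fromDifferences (toDifferences i μ) ≡ μ
fromDifferences-toDifferences i μ μ∈ =
  let w , pos = isPartition⁻ {μ} μ∈
  in trans (cong dropZeros (partialSums-toDifferences i μ w))
           (dropZeros-replicate-0-++ (i ∸ length μ) μ pos)

toDifferences-fromDifferences : ∀ {i} ds → length ds ≡ i → toDifferences i (fromDifferences ds) ≡ ds
toDifferences-fromDifferences ds refl =
  trans (cong (differences 0) pad-partialSums) (differences-partialSums 0 ds)
  where
  pad-partialSums : pad (length ds) (fromDifferences ds) ≡ partialSums 0 ds
  pad-partialSums = subst (λ n → pad n (fromDifferences ds) ≡ partialSums 0 ds)
                          (length-partialSums 0 ds) (pad-dropZeros (partialSums 0 ds))

length-toDifferences : ∀ i μ → length μ ≤ i → length (toDifferences i μ) ≡ i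
length-toDifferences i μ len≤i = trans (length-differences 0 (pad i μ)) (length-pad i μ len≤i)

weight-toDifferences : ∀ i μ → T (weaklyIncr μ) → weight (toDifferences i μ) ≡ size μ
weight-toDifferences i μ w =
  trans (sym (size-partialSums 0 (toDifferences i μ)))
        (trans (cong size (partialSums-toDifferences i μ w)) (size-replicate-0-++ (i ∸ length μ) μ))

fromDifferences-∈𝒫 : ∀ {i} ds → length ds ≡ i → T (inP i (fromDifferences ds))
fromDifferences-∈𝒫 ds refl =
  ∧-intro (dropZeros-isPartition (partialSums 0 ds) (partialSums-weaklyIncr 0 ds))
          (≤⇒≤ᵇ (≤-trans (length-dropZeros (partialSums 0 ds)) (≤-reflexive (length-partialSums 0 ds))))

inP⁻ : ∀ {i} μ → T (inP i μ) → T (isPartition μ) × length μ ≤ i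
inP⁻ {i} μ μ∈ = let part , len = ∧-elim {isPartition μ} μ∈ in part , ≤ᵇ⇒≤ (length μ) i len

-- Partitions into multiples of k

module _ (k : ℕ) .{{_ : NonZero k}} where

  multiples⁻ : ∀ {x} → T (x % k ≡ᵇ 0) → k ∣ x
  multiples⁻ {x} x%k≡0 = m%n≡0⇒n∣m x k (≡ᵇ⇒≡ (x % k) 0 x%k≡0)

  map-*-/ : ∀ η → T (all (λ x → x % k ≡ᵇ 0) η) → map (k *_) (map (_/ k) η) ≡ η
  map-*-/ []      _    = refl
  map-*-/ (x ∷ η) mult =
    let x∣ , η∣ = ∧-elim {x % k ≡ᵇ 0} mult
    in cong₂ _∷_ (m*[n/m]≡n (multiples⁻ x∣)) (map-*-/ η η∣)

  map-/-* : ∀ μ → map (_/ k) (map (k *_) μ) ≡ μ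
  map-/-* []      = refl
  map-/-* (y ∷ μ) = cong₂ _∷_ (trans (cong (_/ k) (*-comm k y)) (m*n/n≡m y k)) (map-/-* μ)

  map-*-multiples : ∀ μ → T (all (λ x → x % k ≡ᵇ 0) (map (k *_) μ))
  map-*-multiples []      = tt
  map-*-multiples (y ∷ μ) = ∧-intro (≡⇒≡ᵇ _ 0 (n∣m⇒m%n≡0 (k * y) k (m∣m*n y))) (map-*-multiples μ)

  map-/-isPartition : ∀ η → T (isPartition η) → T (all (λ x → x % k ≡ᵇ 0) η) →
                      T (isPartition (map (_/ k) η))
  map-/-isPartition η η∈ mult =
    let w , pos = isPartition⁻ {η} η∈
    in isPartition⁺ (weaklyIncr-map (/-monoˡ-≤ k) η w)
         (map⁺ (All.zipWith (λ (1≤x , x∣) → m≥n⇒m/n>0 (∣⇒≤ {{>-nonZero 1≤x}} (multiples⁻ x∣)))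
                            (pos , all⁺ _ η mult)))

  map-*-isPartition : ∀ μ → T (isPartition μ) → T (isPartition (map (k *_) μ))
  map-*-isPartition μ μ∈ =
    let w , pos = isPartition⁻ {μ} μ∈
    in isPartition⁺ (weaklyIncr-map (*-monoʳ-≤ k) μ w)
                    (map⁺ (All.map (*-mono-≤ (>-nonZero⁻¹ k)) pos))

  size-map-* : ∀ μ → size (map (k *_) μ) ≡ k * size μ
  size-map-* []      = sym (*-zeroʳ k)
  size-map-* (y ∷ μ) = trans (cong (k * y +_) (size-map-* μ)) (sym (*-distribˡ-+ k y (size μ)))

inT3⁻ : ∀ {j} η → T (inT3 j η) → T (inP j (map (_/ 3) η)) × T (all (λ x → x % 3 ≡ᵇ 0) η)
inT3⁻ {j} η η∈ =
  let part , η∈′ = ∧-elim {isPartition η} η∈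
      mult , len = ∧-elim {all (λ x → x % 3 ≡ᵇ 0) η} η∈′
  in ∧-intro (map-/-isPartition 3 η part mult)
             (subst (λ n → T (n ≤ᵇ j)) (sym (List.length-map (_/ 3) η)) len) , mult

inT3⁺ : ∀ {j} μ → T (inP j μ) → T (inT3 j (map (3 *_) μ))
inT3⁺ {j} μ μ∈ =
  let part , len = ∧-elim {isPartition μ} μ∈
  in ∧-intro (map-*-isPartition 3 μ part)
     (∧-intro (map-*-multiples 3 μ) (subst (λ n → T (n ≤ᵇ j)) (sym (List.length-map (3 *_) μ)) len))

interleave-zeros : ∀ i j →
  interleave (replicate i 0) (replicate j 0) ≡ replicate j (triple 0) ++ replicate i (single 0)
interleave-zeros zero    j       = trans (List.map-replicate triple j 0) (sym (List.++-identityʳ _))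
interleave-zeros (suc i) zero    = cong (single 0 ∷_) (interleave-zeros i zero)
interleave-zeros (suc i) (suc j) =
  trans (interleave⁺-triple (replicate i 0) (replicate j 0) z≤n)
        (cong (triple 0 ∷_) (interleave-zeros (suc i) j))

blockAt : ℕ → List ℕ
blockAt x = x ∷ x ∷ suc x ∷ []

layout-triples : ∀ n p rest (f : ℕ → List ℕ) → (∀ m → f m ≡ blockAt (p + 3 * m)) →
  layout p (replicate n (triple 0) ++ rest) ≡ concat (applyUpTo f n) ++ layout (p + 3 * n) rest
layout-triples zero    p rest f _  = cong (λ q → layout q rest) (sym (+-identityʳ p))
layout-triples (suc n) p rest f f≡ rewrite f≡ 0 | +-identityʳ p =
  cong (λ xs → p ∷ p ∷ suc p ∷ xs)
    (trans (layout-triples n (3 + p) rest (f ∘ suc) (λ m → trans (f≡ (suc m)) (cong blockAt (shift p m))))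
           (cong (λ q → concat (applyUpTo (f ∘ suc) n) ++ layout q rest) (sym (shift p n))))
  where
  shift : ∀ p m → p + 3 * suc m ≡ 3 + p + 3 * m
  shift = solve-∀

layout-singles : ∀ n p (f : ℕ → ℕ) → (∀ m → f m ≡ p + 2 * m) →
                 layout p (replicate n (single 0)) ≡ applyUpTo f n
layout-singles zero    p f _  = refl
layout-singles (suc n) p f f≡ =
  cong₂ _∷_ (sym (f≡ 0)) (layout-singles n (2 + (p + 0)) (f ∘ suc) (λ m → trans (f≡ (suc m)) (shift p m)))
  where
  shift : ∀ p m → p + 2 * suc m ≡ 2 + (p + 0) + 2 * m
  shift = solve-∀

subtype-≡ : ∀ {P : List ℕ → Bool} {x y : Σ (List ℕ) (T ∘ P)} → proj₁ x ≡ proj₁ y → x ≡ y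
subtype-≡ eq = Σ-≡,≡→≡ (eq , T-irrelevant _ _)

fromGaps : List ℕ × List ℕ → List ℕ
fromGaps (ds , gs) = layout 2 (interleave ds gs)

β-fromGaps : ∀ i j → β i j ≡ fromGaps (replicate i 0 , replicate j 0)
β-fromGaps i j = sym (begin
    layout 2 (interleave (replicate i 0) (replicate j 0))
  ≡⟨ cong (layout 2) (interleave-zeros i j) ⟩
    layout 2 (replicate j (triple 0) ++ replicate i (single 0))
  ≡⟨ layout-triples j 2 (replicate i (single 0)) _
       (λ m → cong (λ n → (n ∸ 1) ∷ (n ∸ 1) ∷ n ∷ []) (*-suc 3 m)) ⟩
    concat (applyUpTo _ j) ++ layout (2 + 3 * j) (replicate i (single 0))
  ≡⟨ cong (concat (applyUpTo _ j) ++_) (layout-singles i (2 + 3 * j) _ (shift j)) ⟩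
    β i j ∎)
  where
  open ≡-Reasoning
  shift : ∀ j m → 3 * j + 2 * suc m ≡ 2 + 3 * j + 2 * m
  shift = solve-∀

fromGaps-∈𝒲 : ∀ ds gs → T (inW (length ds) (length gs) (fromGaps (ds , gs)))
fromGaps-∈𝒲 ds gs =
  let #single≡ , #triple≡ = counts-interleave ds gs
  in subst₂ (λ a b → T (inW a b (fromGaps (ds , gs)))) #single≡ #triple≡ (layout-∈𝒲 (interleave ds gs))

fromGaps-injective : ∀ {x y} → fromGaps x ≡ fromGaps y → x ≡ y
fromGaps-injective {ds , gs} {ds′ , gs′} eq =
  trans (sym (deinterleave-interleave ds gs))
        (trans (cong deinterleave (layout-injective 2 eq)) (deinterleave-interleave ds′ gs′))

fromGaps-surjective : ∀ {i j w} → T (inW i j w) →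
                      ∃ λ x → length (proj₁ x) ≡ i × length (proj₂ x) ≡ j × fromGaps x ≡ w
fromGaps-surjective w∈ =
  let bs , #single≡i , #triple≡j , bs↦w = 𝒲⇒layout w∈
      ds≡ , gs≡ = length-deinterleave bs
  in deinterleave bs , trans ds≡ #single≡i , trans gs≡ #triple≡j ,
     trans (cong (layout 2) (interleave-deinterleave bs)) bs↦w

size-fromGaps : ∀ ds gs →
  size (fromGaps (ds , gs)) ≡
  size (fromGaps (replicate (length ds) 0 , replicate (length gs) 0)) + weight ds + 3 * weight gs
size-fromGaps ds gs =
  trans (size-layout-interleave 2 ds gs)
  (trans (layoutSize-zeros 2 ds gs)
         (cong (λ n → n + weight ds + 3 * weight gs)
               (sym (size-layout-interleave 2 (replicate (length ds) 0) (replicate (length gs) 0)))))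

module _ (i j : ℕ) where

  encode : 𝒫 i × 𝒯³ j → List ℕ × List ℕ
  encode ((μ , _) , (η , _)) = toDifferences i μ , toDifferences j (map (_/ 3) η)

  length-encode : ∀ x → length (proj₁ (encode x)) ≡ i × length (proj₂ (encode x)) ≡ j
  length-encode ((μ , μ∈) , (η , η∈)) =
    length-toDifferences i μ (proj₂ (inP⁻ μ μ∈)) ,
    length-toDifferences j (map (_/ 3) η) (proj₂ (inP⁻ (map (_/ 3) η) (proj₁ (inT3⁻ η η∈))))

  φ : 𝒫 i × 𝒯³ j → 𝒲 i j
  φ x = fromGaps (encode x) ,
        subst₂ (λ a b → T (inW a b (fromGaps (encode x))))
               (proj₁ (length-encode x)) (proj₂ (length-encode x))
               (fromGaps-∈𝒲 (proj₁ (encode x)) (proj₂ (encode x)))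

  fromDifferences-toDifferences-𝒯³ : ∀ {η} → T (inT3 j η) →
    map (3 *_) (fromDifferences (toDifferences j (map (_/ 3) η))) ≡ η
  fromDifferences-toDifferences-𝒯³ {η} η∈ =
    let η/3∈ , mult = inT3⁻ η η∈
    in trans (cong (map (3 *_))
                   (fromDifferences-toDifferences j _ (proj₁ (inP⁻ (map (_/ 3) η) η/3∈))))
             (map-*-/ 3 η mult)

  encode-injective : ∀ {x y} → encode x ≡ encode y → x ≡ y
  encode-injective {(μ , μ∈) , (η , η∈)} {(μ′ , μ′∈) , (η′ , η′∈)} eq =
    cong₂ _,_ (subtype-≡ μ≡μ′) (subtype-≡ η≡η′)
    where
    open ≡-Reasoning
    μ≡μ′ : μ ≡ μ′
    μ≡μ′ = begin
        μ
      ≡⟨ sym (fromDifferences-toDifferences i μ (proj₁ (inP⁻ μ μ∈))) ⟩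
        fromDifferences (toDifferences i μ)
      ≡⟨ cong (fromDifferences ∘ proj₁) eq ⟩
        fromDifferences (toDifferences i μ′)
      ≡⟨ fromDifferences-toDifferences i μ′ (proj₁ (inP⁻ μ′ μ′∈)) ⟩
        μ′ ∎
    η≡η′ : η ≡ η′
    η≡η′ = begin
        η
      ≡⟨ sym (fromDifferences-toDifferences-𝒯³ η∈) ⟩
        map (3 *_) (fromDifferences (toDifferences j (map (_/ 3) η)))
      ≡⟨ cong (map (3 *_) ∘ fromDifferences ∘ proj₂) eq ⟩
        map (3 *_) (fromDifferences (toDifferences j (map (_/ 3) η′)))
      ≡⟨ fromDifferences-toDifferences-𝒯³ η′∈ ⟩
        η′ ∎

  φ-injective : ∀ {x y} → φ x ≡ φ y → x ≡ y
  φ-injective = encode-injective ∘ fromGaps-injective ∘ cong proj₁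

  φ-strictlySurjective : ∀ w → ∃ λ x → φ x ≡ w
  φ-strictlySurjective (w , w∈) =
    let (ds , gs) , ds≡ , gs≡ , ↦w = fromGaps-surjective w∈
        x = (fromDifferences ds , fromDifferences-∈𝒫 ds ds≡) ,
            (map (3 *_) (fromDifferences gs) , inT3⁺ (fromDifferences gs) (fromDifferences-∈𝒫 gs gs≡))
        encode-x = cong₂ _,_ (toDifferences-fromDifferences ds ds≡)
          (trans (cong (toDifferences j) (map-/-* 3 (fromDifferences gs)))
                 (toDifferences-fromDifferences gs gs≡))
    in x , subtype-≡ (trans (cong fromGaps encode-x) ↦w)

  β-∈𝒲 : T (inW i j (β i j))
  β-∈𝒲 = subst (T ∘ inW i j) (sym (β-fromGaps i j))
    (subst₂ (λ a b → T (inW a b (fromGaps (replicate i 0 , replicate j 0))))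
            (List.length-replicate i) (List.length-replicate j)
            (fromGaps-∈𝒲 (replicate i 0) (replicate j 0)))

  size-φ : ∀ μ η → size (proj₁ (φ (μ , η))) ≡ size (β i j) + size (proj₁ μ) + size (proj₁ η)
  size-φ (μ , μ∈) (η , η∈) = begin
      size (fromGaps (ds , gs))
    ≡⟨ size-fromGaps ds gs ⟩
      size (fromGaps (replicate (length ds) 0 , replicate (length gs) 0)) + weight ds + 3 * weight gs
    ≡⟨ cong₂ (λ a b → size (fromGaps (replicate a 0 , replicate b 0)) + weight ds + 3 * weight gs)
             (proj₁ lengths) (proj₂ lengths) ⟩
      size (fromGaps (replicate i 0 , replicate j 0)) + weight ds + 3 * weight gs
    ≡⟨ cong₂ _+_ (cong₂ _+_ (cong size (sym (β-fromGaps i j))) weight-ds) 3weight-gs ⟩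
      size (β i j) + size μ + size η ∎
    where
    open ≡-Reasoning
    ds = toDifferences i μ
    gs = toDifferences j (map (_/ 3) η)
    lengths = length-encode ((μ , μ∈) , (η , η∈))
    weight-ds : weight ds ≡ size μ
    weight-ds = weight-toDifferences i μ (proj₁ (isPartition⁻ {μ} (proj₁ (inP⁻ μ μ∈))))
    3weight-gs : 3 * weight gs ≡ size η
    3weight-gs =
      let η/3∈ , mult = inT3⁻ η η∈
      in begin
          3 * weight gs
        ≡⟨ cong (3 *_) (weight-toDifferences j (map (_/ 3) η)
             (proj₁ (isPartition⁻ {map (_/ 3) η} (proj₁ (inP⁻ (map (_/ 3) η) η/3∈))))) ⟩
          3 * size (map (_/ 3) η)
        ≡⟨ sym (size-map-* 3 (map (_/ 3) η)) ⟩
          size (map (3 *_) (map (_/ 3) η))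
        ≡⟨ cong size (map-*-/ 3 η mult) ⟩
          size η ∎

  φ-statistics : (μ : 𝒫 i) (η : 𝒯³ j) →
                 (size (proj₁ (φ (μ , η))) ≡ size (β i j) + size (proj₁ μ) + size (proj₁ η))
                 × (len (proj₁ (φ (μ , η))) ≡ len (β i j))
                 × (ℓr (proj₁ (φ (μ , η))) ≡ ℓr (β i j))
  φ-statistics μ η =
    let len-φ , ℓr-φ = 𝒲-statistics {i} (proj₁ (φ (μ , η))) (proj₂ (φ (μ , η)))
        len-β , ℓr-β = 𝒲-statistics {i} (β i j) β-∈𝒲
    in size-φ μ η , trans len-φ (sym len-β) , trans ℓr-φ (sym ℓr-β)

lemma5p4 : (i j : ℕ) →
    Σ (𝒫 i × 𝒯³ j → 𝒲 i j) (λ φ →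
      Bijective _≡_ _≡_ φ
      × ((μ : 𝒫 i) (η : 𝒯³ j) →
           (size (proj₁ (φ (μ , η))) ≡ size (β i j) + size (proj₁ μ) + size (proj₁ η))
           × (len (proj₁ (φ (μ , η))) ≡ len (β i j))
           × (ℓr (proj₁ (φ (μ , η))) ≡ ℓr (β i j))))
lemma5p4 i j =
  φ i j , (φ-injective i j , strictlySurjective⇒surjective (φ-strictlySurjective i j)) , φ-statistics i j
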